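{- Let $M_1,M_2$ be $\omega$-saturated $\Theta$-models, let $x$ be a variable, and let $t\in U_1$, $t'\in U_2$ satisfy $tp_x(M_1,t)\subseteq tp_x(M_2,t')$. Let $A=\{\langle a,b\rangle:\exists \mu,\nu\,(\{\mu,\nu\}=\{1,2\},\ a\in U_\mu,\ b\in U_\nu,\ tp_x(M_\mu,a)\subseteq tp_x(M_\nu,b))\}$ and $B=\{\langle a,b\rangle:\exists \mu,\nu\,(\{\mu,\nu\}=\{1,2\},\ a\in U_\mu,\ b\in U_\nu,\ imp_x(M_\mu,a)\supseteq imp_x(M_\nu,b))\}$. Then $(A,B)$ is a $(2,2)$-modal $\langle(M_1,t),(M_2,t')\rangle$-asimulation.
   Context: Correspondence language: classical first-order logic without identity over $\Sigma=\{R,R_\Box,R_\Diamond,P_1,P_2,\dots\}$, $R,R_\Box,R_\Diamond$ binary, $P_n$ unary. For $\Theta\subseteq\Sigma$ containing $R,R_\Box,R_\Diamond$, a $\Theta$-model $M_\mu=\langle U_\mu,\iota_\mu\rangle$ is a classical structure for $\Theta$; write $R_\mu,R_{\Box\mu},R_{\Diamond\mu}$ for the interpretations. A model $M$ is $\omega$-saturated if for every finite tuple $\bar a$ of its elements, every set of formulas in finitely many free variables (with parameters $\bar a$) that is finitely satisfiable in $M$ (equivalently, consistent with the theory of $M$ expanded by constants for $\bar a$) is realized in $M$. Modal intuitionistic formulas are built from letters $p_n$ and $\bot$ by $\wedge,\vee,\to,\Box,\Diamond$. $ST_{22}(p_n,x)=P_n(x)$, $ST_{22}(\bot,x)=\bot$,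 $\wedge,\vee$ componentwise, $ST_{22}(I\to J,x)=\forall y(R(x,y)\to(ST_{22}(I,y)\to ST_{22}(J,y)))$, $ST_{22}(\Box I,x)=\forall y(R(x,y)\to\forall z(R_\Box(y,z)\to ST_{22}(I,z)))$, $ST_{22}(\Diamond I,x)=\forall y(R(x,y)\to\exists z(R_\Diamond(y,z)\wedge ST_{22}(I,z)))$. $int_x(\Theta)$ is the set of all formulas $ST_{22}(I,x)$ that use only predicate letters of $\Theta$. For a $\Theta$-model $M$ and $s\in U$: $tp_x(M,s)=\{\varphi(x)\in int_x(\Theta):M,s\models\varphi(x)\}$; $\overline{tp}_x(M,s)=\{\varphi(x)\in int_x(\Theta):M,s\not\models\varphi(x)\}$; $imp_x(M,s)=\bigcap\{\overline{tp}_x(M,w): \iota(R_\Diamond)(s,w)\}$. A $(2,2)$-modal $\langle(M_1,t),(M_2,t')\rangle$-asimulation is a pair $(A,B)$ of binary relations such that for all $\mu,\nu\in\{1,2\}$, $a,c,e\in U_\mu$, $b,d,f\in U_\nu$, unary $P\in\Theta$: $A,B\subseteq(U_1\times U_2)\cup(U_2\times U_1)$; $tAt'$; if $aAb$ and $M_\mu,a\models P(x)$ then $M_\nu,b\models P(x)$; if $aAb$ and $bR_\nu d$ then some $c\in U_\mu$ has $aR_\mu c$, $cAd$, $dAc$; if $aAb$, $bR_\nu d$, $dR_{\Box\nu}f$ then some $c,e\in U_\mu$ have $aR_\mu c$, $cR_{\Box\mu}e$, $eAf$; if $aAb$ and $bR_\nu d$ then some $c\in U_\mu$ has $aR_\mu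 c$ and $cBd$; if $aBb$ and $aR_{\Diamond\mu}c$ then some $d\in U_\nu$ has $bR_{\Diamond\nu}d$ and $cAd$. -}

module Defs where

open import Level using (0ℓ)
open import Data.Nat using (ℕ; suc; _+_)
open import Data.Fin using (Fin; zero; suc)
open import Data.Product using (Σ; _×_; _,_; proj₁)
open import Data.Sum using (_⊎_)
open import Data.Empty using (⊥)
open import Data.List using (List)
open import Data.List.Relation.Unary.All using (All)
open import Data.Vec.Functional using (Vector; []; _∷_; _++_)
open import Relation.Nullary using (¬_)
open import Relation.Binary.PropositionalEquality using (_≡_; _≢_)

-- Θ ⊆ Σ is given by the set of indices n such that P_n ∈ Θ;
-- R, R_□, R_◇ always belong to Θ.

data BinSym : Set where
  `R `R□ `R◇ : BinSym

record Model (Θ : ℕ → Set) : Set₁ where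
  field
    U  : Set
    R  : U → U → Set
    R□ : U → U → Set
    R◇ : U → U → Set
    P  : (n : ℕ) → Θ n → U → Set

  relOf : BinSym → U → U → Set
  relOf `R  = R
  relOf `R□ = R□
  relOf `R◇ = R◇

open Model public

-- First-order formulas over Θ without identity, well-scoped:
-- Formula Θ n has its free variables among Fin n (de Bruijn).
infixr 5 _⇒_
infixr 6 _∨'_
infixr 7 _∧'_
data Formula (Θ : ℕ → Set) : ℕ → Set where
  rel  : ∀ {n} → BinSym → Fin n → Fin n → Formula Θ n
  pred : ∀ {n} (k : ℕ) → Θ k → Fin n → Formula Θ n
  ⊥'   : ∀ {n} → Formula Θ n
  _∧'_ : ∀ {n} → Formula Θ n → Formula Θ n → Formula Θ n
  _∨'_ : ∀ {n} → Formula Θ n → Formula Θ n → Formula Θ n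
  _⇒_  : ∀ {n} → Formula Θ n → Formula Θ n → Formula Θ n
  all  : ∀ {n} → Formula Θ (suc n) → Formula Θ n
  ex   : ∀ {n} → Formula Θ (suc n) → Formula Θ n

-- Satisfaction (Tarskian; classical reading obtained via excluded middle
-- assumed as a hypothesis of the theorem).
Sat : ∀ {Θ} (M : Model Θ) {n} → Formula Θ n → Vector (U M) n → Set
Sat M (rel s i j) ρ = relOf M s (ρ i) (ρ j)
Sat M (pred k θ i) ρ = P M k θ (ρ i)
Sat M ⊥' ρ = ⊥
Sat M (φ ∧' ψ) ρ = Sat M φ ρ × Sat M ψ ρ
Sat M (φ ∨' ψ) ρ = Sat M φ ρ ⊎ Sat M ψ ρ
Sat M (φ ⇒ ψ) ρ = Sat M φ ρ → Sat M ψ ρ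
Sat M (all φ) ρ = (u : U M) → Sat M φ (u ∷ ρ)
Sat M (ex φ) ρ = Σ (U M) λ u → Sat M φ (u ∷ ρ)

-- Variables 0..k-1 are the unknowns, variables k..k+n-1 denote ā.
FinSat : ∀ {Θ} (M : Model Θ) (k : ℕ) {n} → Vector (U M) n → (Formula Θ (k + n) → Set) → Set
FinSat M k ā Γ = (Δ : List (Formula _ (k + _))) → All Γ Δ →
  Σ (Vector (U M) k) λ x → All (λ φ → Sat M φ (x ++ ā)) Δ

Realized : ∀ {Θ} (M : Model Θ) (k : ℕ) {n} → Vector (U M) n → (Formula Θ (k + n) → Set) → Set
Realized M k ā Γ = Σ (Vector (U M) k) λ x → (φ : Formula _ (k + _)) → Γ φ → Sat M φ (x ++ ā)

OmegaSaturated : ∀ {Θ} → Model Θ → Set₁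
OmegaSaturated {Θ} M = (k n : ℕ) (ā : Vector (U M) n) (Γ : Formula Θ (k + n) → Set) →
  FinSat M k ā Γ → Realized M k ā Γ

data MFormula (Θ : ℕ → Set) : Set where
  p    : (k : ℕ) → Θ k → MFormula Θ
  ⊥ᵐ   : MFormula Θ
  _∧ᵐ_ _∨ᵐ_ _→ᵐ_ : MFormula Θ → MFormula Θ → MFormula Θ
  □ᵐ ◇ᵐ : MFormula Θ → MFormula Θ

ST : ∀ {Θ} → MFormula Θ → ∀ {n} → Fin n → Formula Θ n
ST (p k θ) x = pred k θ x
ST ⊥ᵐ x = ⊥'
ST (I ∧ᵐ J) x = ST I x ∧' ST J x
ST (I ∨ᵐ J) x = ST I x ∨' ST J x
ST (I →ᵐ J) x = all (rel `R (suc x) zero ⇒ (ST I zero ⇒ ST J zero))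
ST (□ᵐ I) x = all (rel `R (suc x) zero ⇒ all (rel `R□ (suc zero) zero ⇒ ST I zero))
ST (◇ᵐ I) x = all (rel `R (suc x) zero ⇒ ex (rel `R◇ (suc zero) zero ∧' ST I zero))

IntX : ∀ {Θ} → Formula Θ 1 → Set
IntX {Θ} φ = Σ (MFormula Θ) λ I → ST I zero ≡ φ

tp : ∀ {Θ} (M : Model Θ) → U M → Formula Θ 1 → Set
tp M s φ = IntX φ × Sat M φ (s ∷ [])

tpbar : ∀ {Θ} (M : Model Θ) → U M → Formula Θ 1 → Set
tpbar M s φ = IntX φ × ¬ Sat M φ (s ∷ [])

-- imp_x(M,s) = ⋂ { tpbar_x(M,w) : R_◇(s,w) } (intersection taken inside int_x)
imp : ∀ {Θ} (M : Model Θ) → U M → Formula Θ 1 → Set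
imp M s φ = IntX φ × ((w : U M) → R◇ M s w → tpbar M w φ)

_⊆ᶠ_ : ∀ {Θ} → (Formula Θ 1 → Set) → (Formula Θ 1 → Set) → Set
X ⊆ᶠ Y = ∀ φ → X φ → Y φ

-- Two models indexed by Fin 2 (index zero = M_1, index suc zero = M_2);
-- points of U_1 ∪ U_2 are pairs (μ , a) with a ∈ U_μ.
Pt : ∀ {Θ} → (Fin 2 → Model Θ) → Set
Pt M = Σ (Fin 2) λ μ → U (M μ)

record Asimulation {Θ : ℕ → Set} (M : Fin 2 → Model Θ)
    (t : U (M zero)) (t' : U (M (suc zero)))
    (A B : Pt M → Pt M → Set) : Set where
  field
    A-sep : ∀ {p q} → A p q → proj₁ p ≢ proj₁ q
    B-sep : ∀ {p q} → B p q → proj₁ p ≢ proj₁ q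
    root  : A (zero , t) (suc zero , t')
    atom  : ∀ μ ν (a : U (M μ)) (b : U (M ν)) → A (μ , a) (ν , b) →
            ∀ k (θ : Θ k) → P (M μ) k θ a → P (M ν) k θ b
    forth : ∀ μ ν (a : U (M μ)) (b d : U (M ν)) → A (μ , a) (ν , b) → R (M ν) b d →
            Σ (U (M μ)) λ c → R (M μ) a c × A (μ , c) (ν , d) × A (ν , d) (μ , c)
    box   : ∀ μ ν (a : U (M μ)) (b d f : U (M ν)) → A (μ , a) (ν , b) →
            R (M ν) b d → R□ (M ν) d f →
            Σ (U (M μ)) λ c → Σ (U (M μ)) λ e →
              R (M μ) a c × R□ (M μ) c e × A (μ , e) (ν , f)
    toB   : ∀ μ ν (a : U (M μ)) (b d : U (M ν)) → A (μ , a) (ν , b) → R (M ν) b d →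
            Σ (U (M μ)) λ c → R (M μ) a c × B (μ , c) (ν , d)
    dia   : ∀ μ ν (a c : U (M μ)) (b : U (M ν)) → B (μ , a) (ν , b) → R◇ (M μ) a c →
            Σ (U (M ν)) λ d → R◇ (M ν) b d × A (μ , c) (ν , d)

Aᵗᵖ : ∀ {Θ} (M : Fin 2 → Model Θ) → Pt M → Pt M → Set
Aᵗᵖ M (μ , a) (ν , b) = μ ≢ ν × (tp (M μ) a ⊆ᶠ tp (M ν) b)

Bⁱᵐᵖ : ∀ {Θ} (M : Fin 2 → Model Θ) → Pt M → Pt M → Set
Bⁱᵐᵖ M (μ , a) (ν , b) = μ ≢ ν × (imp (M ν) b ⊆ᶠ imp (M μ) a)

module Submission where

-- A
--    finite subfamily of the required type is realized because otherwise
--    (by excluded middle) a finite conjunction/disjunction built with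
--    →, □ or ◇ would be true on one side and false on the other.
-- 4. The theorem assembles the step lemmas into the asimulation record.

open import Defs
open import Level using (0ℓ)
open import Data.Nat using (ℕ; _+_)
open import Data.Fin using (Fin; zero; suc)
open import Axiom.ExcludedMiddle using (ExcludedMiddle)
open import Axiom.DoubleNegationElimination using (em⇒dne)
open import Data.Product using (Σ; _×_; _,_; proj₁; proj₂)
open import Data.Sum using (_⊎_; inj₁; inj₂)
open import Data.Empty using (⊥)
open import Data.List using (List; []; _∷_; foldr; map)
open import Data.List.Membership.Propositional using (_∈_)
open import Data.List.Membership.Propositional.Properties using (∈-map⁺)
open import Data.List.Relation.Unary.Any using (here; there)
open import Data.List.Relation.Unary.All using (All; []; _∷_; tabulate)
import Data.List.Relation.Unary.All as All
open import Data.List.Relation.Unary.All.Properties using (map⁺)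
open import Data.Vec.Functional using (Vector) renaming ([] to []ᵛ; _∷_ to _∷ᵛ_; _++_ to _++ᵛ_)
open import Relation.Nullary using (¬_)
open import Relation.Binary.PropositionalEquality using (_≡_; refl; ≢-sym)

⟦_⟧ : ∀ {Θ} → MFormula Θ → (M : Model Θ) → U M → Set
⟦ p k θ ⟧ M s = P M k θ s
⟦ ⊥ᵐ ⟧ M s = ⊥
⟦ I ∧ᵐ J ⟧ M s = ⟦ I ⟧ M s × ⟦ J ⟧ M s
⟦ I ∨ᵐ J ⟧ M s = ⟦ I ⟧ M s ⊎ ⟦ J ⟧ M s
⟦ I →ᵐ J ⟧ M s = ∀ u → R M s u → ⟦ I ⟧ M u → ⟦ J ⟧ M u
⟦ □ᵐ I ⟧ M s = ∀ u → R M s u → ∀ v → R□ M u v → ⟦ I ⟧ M v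
⟦ ◇ᵐ I ⟧ M s = ∀ u → R M s u → Σ (U M) λ v → R◇ M u v × ⟦ I ⟧ M v

-- Correctness of the standard translation, for any variable and environment;
-- both directions are needed at once because of the contravariance of →.
ST-sound : ∀ {Θ} {M : Model Θ} I {n} {x : Fin n} {ρ} → Sat M (ST I x) ρ → ⟦ I ⟧ M (ρ x)
ST-complete : ∀ {Θ} {M : Model Θ} I {n} {x : Fin n} {ρ} → ⟦ I ⟧ M (ρ x) → Sat M (ST I x) ρ

ST-sound (p k θ) s = s
ST-sound ⊥ᵐ s = s
ST-sound (I ∧ᵐ J) (s , s') = ST-sound I s , ST-sound J s'
ST-sound (I ∨ᵐ J) (inj₁ s) = inj₁ (ST-sound I s)
ST-sound (I ∨ᵐ J) (inj₂ s) = inj₂ (ST-sound J s)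
ST-sound (I →ᵐ J) s u r i = ST-sound J (s u r (ST-complete I i))
ST-sound (□ᵐ I) s u r v r' = ST-sound I (s u r v r')
ST-sound (◇ᵐ I) s u r with s u r
... | v , r' , i = v , r' , ST-sound I i

ST-complete (p k θ) s = s
ST-complete ⊥ᵐ s = s
ST-complete (I ∧ᵐ J) (s , s') = ST-complete I s , ST-complete J s'
ST-complete (I ∨ᵐ J) (inj₁ s) = inj₁ (ST-complete I s)
ST-complete (I ∨ᵐ J) (inj₂ s) = inj₂ (ST-complete J s)
ST-complete (I →ᵐ J) s u r i = ST-complete J (s u r (ST-sound I i))
ST-complete (□ᵐ I) s u r v r' = ST-complete I (s u r v r')
ST-complete (◇ᵐ I) s u r with s u r
... | v , r' , i = v , r' , ST-complete I i

Preserves : ∀ {Θ} (M : Model Θ) → U M → (N : Model Θ) → U N → Set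
Preserves {Θ} M a N b = (I : MFormula Θ) → ⟦ I ⟧ M a → ⟦ I ⟧ N b

◇Refuted : ∀ {Θ} (M : Model Θ) → U M → MFormula Θ → Set
◇Refuted M a I = ∀ w → R◇ M a w → ¬ ⟦ I ⟧ M w

RefutationsTransfer : ∀ {Θ} (N : Model Θ) → U N → (M : Model Θ) → U M → Set
RefutationsTransfer {Θ} N b M a = (I : MFormula Θ) → ◇Refuted N b I → ◇Refuted M a I

tp⊆⇒preserves : ∀ {Θ} {M N : Model Θ} {a b} → tp M a ⊆ᶠ tp N b → Preserves M a N b
tp⊆⇒preserves h I aI = ST-sound I (proj₂ (h (ST I zero) ((I , refl) , ST-complete I aI)))

preserves⇒tp⊆ : ∀ {Θ} {M N : Model Θ} {a b} → Preserves M a N b → tp M a ⊆ᶠ tp N b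
preserves⇒tp⊆ h φ ((I , refl) , aI) = (I , refl) , ST-complete I (h I (ST-sound I aI))

imp⊆⇒transfer : ∀ {Θ} {M N : Model Θ} {a b} → imp N b ⊆ᶠ imp M a → RefutationsTransfer N b M a
imp⊆⇒transfer h I bRefutes w aw wI =
  proj₂ (proj₂ (h (ST I zero) ((I , refl) , b-imp)) w aw) (ST-complete I wI)
  where
  b-imp = λ w' bw' → (I , refl) , λ s → bRefutes w' bw' (ST-sound I s)

transfer⇒imp⊆ : ∀ {Θ} {M N : Model Θ} {a b} → RefutationsTransfer N b M a → imp N b ⊆ᶠ imp M a
transfer⇒imp⊆ h φ ((I , refl) , bImp) = (I , refl) , λ w aw →
  (I , refl) , λ s → h I (λ w' bw' wI → proj₂ (bImp w' bw') (ST-complete I wI)) w aw (ST-sound I s)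

⊤ᵐ : ∀ {Θ} → MFormula Θ
⊤ᵐ = ⊥ᵐ →ᵐ ⊥ᵐ

⊤ᵐ-true : ∀ {Θ} {M : Model Θ} {s} → ⟦ ⊤ᵐ ⟧ M s
⊤ᵐ-true _ _ z = z

⋀ : ∀ {Θ} → List (MFormula Θ) → MFormula Θ
⋀ = foldr _∧ᵐ_ ⊤ᵐ

⋁ : ∀ {Θ} → List (MFormula Θ) → MFormula Θ
⋁ = foldr _∨ᵐ_ ⊥ᵐ

module _ {Θ} {M : Model Θ} {s : U M} where

  ⋀-intro : ∀ {Is} → All (λ I → ⟦ I ⟧ M s) Is → ⟦ ⋀ Is ⟧ M s
  ⋀-intro [] = ⊤ᵐ-true {M = M}
  ⋀-intro (i ∷ is) = i , ⋀-intro is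

  ⋀-elim : ∀ {I Is} → I ∈ Is → ⟦ ⋀ Is ⟧ M s → ⟦ I ⟧ M s
  ⋀-elim (here refl) (i , _) = i
  ⋀-elim (there I∈) (_ , is) = ⋀-elim I∈ is

  ⋁-intro : ∀ {I Is} → I ∈ Is → ⟦ I ⟧ M s → ⟦ ⋁ Is ⟧ M s
  ⋁-intro (here refl) i = inj₁ i
  ⋁-intro (there I∈) i = inj₂ (⋁-intro I∈ i)

  ⋁-refute : ∀ {Is} → All (λ I → ¬ ⟦ I ⟧ M s) Is → ¬ ⟦ ⋁ Is ⟧ M s
  ⋁-refute (n ∷ ns) (inj₁ i) = n i
  ⋁-refute (n ∷ ns) (inj₂ is) = ⋁-refute ns is

FinitelyRealized : ∀ {Θ} (M : Model Θ) k {n} (ā : Vector (U M) n) (base : Formula Θ (k + n))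
  {T : Set} (F : T → Formula Θ (k + n)) (Q : T → Set) → Set
FinitelyRealized M k ā base {T} F Q = (is : List T) → All Q is → Σ (Vector (U M) k) λ x →
  Sat M base (x ++ᵛ ā) × All (λ i → Sat M (F i) (x ++ᵛ ā)) is

realize : ∀ {Θ} {M : Model Θ} → OmegaSaturated M →
  ∀ k {n} (ā : Vector (U M) n) (base : Formula Θ (k + n)) {T : Set}
  (F : T → Formula Θ (k + n)) (Q : T → Set) → FinitelyRealized M k ā base F Q →
  Σ (Vector (U M) k) λ x → Sat M base (x ++ᵛ ā) × (∀ i → Q i → Sat M (F i) (x ++ᵛ ā))
realize {Θ} {M} sat k {n} ā base {T} F Q finite
  with sat k n ā Family finitelySatisfiable
  where
  Family : Formula Θ (k + n) → Set
  Family φ = base ≡ φ ⊎ Σ T λ i → Q i × F i ≡ φ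

  indices : (Δ : List (Formula Θ (k + n))) → All Family Δ →
    Σ (List T) λ is → All Q is ×
      (∀ ρ → Sat M base ρ → All (λ i → Sat M (F i) ρ) is → All (λ φ → Sat M φ ρ) Δ)
  indices [] [] = [] , [] , λ _ _ _ → []
  indices (φ ∷ Δ) (inj₁ refl ∷ γ) with indices Δ γ
  ... | is , qs , covers = is , qs , λ ρ b fs → b ∷ covers ρ b fs
  indices (φ ∷ Δ) (inj₂ (i , q , refl) ∷ γ) with indices Δ γ
  ... | is , qs , covers = i ∷ is , q ∷ qs , λ { ρ b (f ∷ fs) → f ∷ covers ρ b fs }

  finitelySatisfiable : FinSat M k ā Family
  finitelySatisfiable Δ γ with indices Δ γ
  ... | is , qs , covers with finite is qs
  ... | x , b , fs = x , covers (x ++ᵛ ā) b fs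
... | x , sats = x , sats base (inj₁ refl) , λ i q → sats (F i) (inj₂ (i , q , refl))

module Steps (em : ExcludedMiddle 0ℓ) {Θ : ℕ → Set} {M N : Model Θ} where

  dne : {X : Set} → ¬ ¬ X → X
  dne = em⇒dne em

  forth : OmegaSaturated M → ∀ {a b d} → Preserves M a N b → R N b d →
          Σ (U M) λ c → R M a c × Preserves M c N d × Preserves N d M c
  forth sat {a} {b} {d} a≼b bd
    with realize sat 1 (a ∷ᵛ []ᵛ) (rel `R (suc zero) zero) literal Agrees finite
    where
    Agrees : MFormula Θ × MFormula Θ → Set
    Agrees (I , J) = ⟦ I ⟧ N d × ¬ ⟦ J ⟧ N d

    literal : MFormula Θ × MFormula Θ → Formula Θ 2
    literal (I , J) = ST I zero ∧' (ST J zero ⇒ ⊥')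

    -- otherwise ⋀ Is → ⋁ Js would hold at a but fail at b
    finite : FinitelyRealized M 1 (a ∷ᵛ []ᵛ) (rel `R (suc zero) zero) literal Agrees
    finite Ps ags with dne (λ noWitness → ⋁-refute (map⁺ (All.map proj₂ ags))
        (a≼b (⋀ Is →ᵐ ⋁ Js) (λ u au ⋀u → dne λ ¬⋁u → noWitness (u , au , ⋀u , ¬⋁u))
             d bd (⋀-intro (map⁺ (All.map proj₁ ags)))))
      where
      Is Js : List (MFormula Θ)
      Is = map proj₁ Ps
      Js = map proj₂ Ps
    ... | c , ac , ⋀c , ¬⋁c = (c ∷ᵛ []ᵛ) , ac , tabulate λ {P} P∈ →
      ST-complete (proj₁ P) (⋀-elim (∈-map⁺ proj₁ P∈) ⋀c) ,
      λ s → ¬⋁c (⋁-intro (∈-map⁺ proj₂ P∈) (ST-sound (proj₂ P) s))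
  ... | x , ac , sats = x zero , ac ,
    (λ I cI → dne λ ¬dI → proj₂ (sats (⊤ᵐ , I) (⊤ᵐ-true {M = N} , ¬dI)) (ST-complete I cI)) ,
    (λ I dI → ST-sound I (proj₁ (sats (I , ⊥ᵐ) (dI , λ ()))))

  box : OmegaSaturated M → ∀ {a b d f} → Preserves M a N b → R N b d → R□ N d f →
        Σ (U M) λ c → Σ (U M) λ e → R M a c × R□ M c e × Preserves M e N f
  box sat {a} {b} {d} {f} a≼b bd df
    with realize sat 2 (a ∷ᵛ []ᵛ) base (λ I → ST I (suc zero) ⇒ ⊥') (λ I → ¬ ⟦ I ⟧ N f) finite
    where
    -- the unknowns c (variable 0) and e (variable 1) satisfy R a c and R□ c e
    base : Formula Θ 3
    base = rel `R (suc (suc zero)) zero ∧' rel `R□ zero (suc zero)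

    -- otherwise □ ⋁ Is would hold at a but fail at b
    finite : FinitelyRealized M 2 (a ∷ᵛ []ᵛ) base (λ I → ST I (suc zero) ⇒ ⊥') (λ I → ¬ ⟦ I ⟧ N f)
    finite Is ¬fs with dne (λ noWitness → ⋁-refute ¬fs
        (a≼b (□ᵐ (⋁ Is)) (λ u au v uv → dne λ ¬⋁v → noWitness (u , v , au , uv , ¬⋁v)) d bd f df))
    ... | c , e , ac , ce , ¬⋁e = (c ∷ᵛ e ∷ᵛ []ᵛ) , (ac , ce) ,
      tabulate λ {I} I∈ s → ¬⋁e (⋁-intro I∈ (ST-sound I s))
  ... | x , (ac , ce) , sats = x zero , x (suc zero) , ac , ce ,
    λ I eI → dne λ ¬fI → sats I ¬fI (ST-complete I eI)

  toB : OmegaSaturated M → ∀ {a b d} → Preserves M a N b → R N b d →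
        Σ (U M) λ c → R M a c × RefutationsTransfer N d M c
  toB sat {a} {b} {d} a≼b bd
    with realize sat 1 (a ∷ᵛ []ᵛ) (rel `R (suc zero) zero) ◇¬ (◇Refuted N d) finite
    where
    ◇¬ : MFormula Θ → Formula Θ 2
    ◇¬ I = all (rel `R◇ (suc zero) zero ⇒ (ST I zero ⇒ ⊥'))

    -- otherwise ◇ ⋁ Is would hold at a but fail at b
    finite : FinitelyRealized M 1 (a ∷ᵛ []ᵛ) (rel `R (suc zero) zero) ◇¬ (◇Refuted N d)
    finite Is refs with dne (λ noWitness → let
        v , dv , ⋁v = a≼b (◇ᵐ (⋁ Is)) (λ u au → dne λ ¬◇u →
                        noWitness (u , au , λ w uw ⋁w → ¬◇u (w , uw , ⋁w))) d bd
      in ⋁-refute (All.map (λ ref → ref v dv) refs) ⋁v)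
    ... | c , ac , ◇¬⋁c = (c ∷ᵛ []ᵛ) , ac ,
      tabulate λ {I} I∈ w cw s → ◇¬⋁c w cw (⋁-intro I∈ (ST-sound I s))
  ... | x , ac , sats = x zero , ac , λ I ref w cw wI → sats I ref w cw (ST-complete I wI)

  dia : OmegaSaturated N → ∀ {a b c} → RefutationsTransfer N b M a → R◇ M a c →
        Σ (U N) λ d → R◇ N b d × Preserves M c N d
  dia sat {a} {b} {c} b⊒a ac
    with realize sat 1 (b ∷ᵛ []ᵛ) (rel `R◇ (suc zero) zero) (λ I → ST I zero) (λ I → ⟦ I ⟧ M c) finite
    where
    -- otherwise ⋀ Is would be ◇-refuted at b but not at a
    finite : FinitelyRealized N 1 (b ∷ᵛ []ᵛ) (rel `R◇ (suc zero) zero) (λ I → ST I zero) (λ I → ⟦ I ⟧ M c)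
    finite Is cs with dne (λ noWitness →
      b⊒a (⋀ Is) (λ w bw ⋀w → noWitness (w , bw , ⋀w)) c ac (⋀-intro cs))
    ... | d , bd , ⋀d = (d ∷ᵛ []ᵛ) , bd , tabulate λ {I} I∈ → ST-complete I (⋀-elim I∈ ⋀d)
  ... | x , bd , sats = x zero , bd , λ I cI → ST-sound I (sats I cI)

lemma7 : ExcludedMiddle 0ℓ → (Θ : ℕ → Set) (M : Fin 2 → Model Θ) →
    OmegaSaturated (M zero) → OmegaSaturated (M (suc zero)) →
    (t : U (M zero)) (t' : U (M (suc zero))) →
    tp (M zero) t ⊆ᶠ tp (M (suc zero)) t' →
    Asimulation M t t' (Aᵗᵖ M) (Bⁱᵐᵖ M)
lemma7 em Θ M sat₁ sat₂ t t' tt' = record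
  { A-sep = proj₁
  ; B-sep = proj₁
  ; root  = (λ ()) , tt'
  ; atom  = λ μ ν a b (_ , ab) k θ → tp⊆⇒preserves ab (p k θ)
  ; forth = λ μ ν a b d (μ≢ν , ab) bd →
      let c , ac , c≼d , d≼c = forth (saturated μ) (tp⊆⇒preserves ab) bd
      in c , ac , (μ≢ν , preserves⇒tp⊆ c≼d) , (≢-sym μ≢ν , preserves⇒tp⊆ d≼c)
  ; box   = λ μ ν a b d f (μ≢ν , ab) bd df →
      let c , e , ac , ce , e≼f = box (saturated μ) (tp⊆⇒preserves ab) bd df
      in c , e , ac , ce , (μ≢ν , preserves⇒tp⊆ e≼f)
  ; toB   = λ μ ν a b d (μ≢ν , ab) bd →
      let c , ac , d⊒c = toB (saturated μ) (tp⊆⇒preserves ab) bd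
      in c , ac , (μ≢ν , transfer⇒imp⊆ d⊒c)
  ; dia   = λ μ ν a c b (μ≢ν , ab) ac →
      let d , bd , c≼d = dia (saturated ν) (imp⊆⇒transfer ab) ac
      in d , bd , (μ≢ν , preserves⇒tp⊆ c≼d)
  }
  where
  open Steps em
  saturated : ∀ μ → OmegaSaturated (M μ)
  saturated zero = sat₁
  saturated (suc zero) = sat₂
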